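{- Let $\mathbb{M}\in\{\mathsf K,\mathsf D,\mathsf T,\mathsf{K4},\mathsf{S4}\}$. Given a $2_{\mathbb M}$-proof $\Pi$ of a 2-sequent $\Gamma\vdash\Delta$, there is a $2_{\mathbb M}$-proof $\Pi'$ of $\Gamma\vdash\Delta$ in which all eigenpositions are distinct from one another.
   Context: Modal formulas over proposition symbols with $\neg,\wedge,\vee,\to,\Box,\Diamond$. Fix a countably infinite set of tokens; a position is a finite (possibly empty) sequence of tokens, $\circ$ concatenation, $\alpha\circ x=\alpha\circ\langle x\rangle$, $\beta\preceq\alpha$ means $\beta$ is a prefix of $\alpha$. A p-formula is $A^\alpha$; a 2-sequent is $\Gamma\vdash\Delta$ with $\Gamma,\Delta$ finite sequences of p-formulas; $I(\Gamma)=\{\beta:\exists A^\alpha\in\Gamma,\ \beta\preceq\alpha\}$. Calculus $2_{\mathsf{S4}}$: Axiom $A^\alpha\vdash A^\alpha$; Cut: from $\Gamma_1\vdash A^\alpha,\Delta_1$ and $\Gamma_2,A^\alpha\vdash\Delta_2$ infer $\Gamma_1,\Gamma_2\vdash\Delta_1,\Delta_2$; weakening, contraction, exchange; classical propositional sequent rules for $\neg,\wedge,\vee,\to$ with all active p-formulas at the same position; modal rules: ($\Box\vdash$) from $\Gamma,A^{\alpha\circ\beta}\vdash\Delta$ infer $\Gamma,(\Box A)^\alpha\vdash\Delta$; ($\vdash\Box$) from $\Gamma\vdash A^{\alpha\circ x},\Delta$ infer $\Gamma\vdash(\Box A)^\alpha,\Delta$; ($\Diamond\vdash$) from $\Gamma,A^{\alpha\circ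 x}\vdash\Delta$ infer $\Gamma,(\Diamond A)^\alpha\vdash\Delta$; ($\vdash\Diamond$) from $\Gamma\vdash A^{\alpha\circ\beta},\Delta$ infer $\Gamma\vdash(\Diamond A)^\alpha,\Delta$; $\beta$ a position, $x$ a token, and in $\vdash\Box,\Diamond\vdash$, $\alpha\circ x\notin I(\Gamma,\Delta)$; the position $\alpha\circ x$ of an application of $\vdash\Box$ or $\Diamond\vdash$ is called its eigenposition. $2_{\mathsf T},2_{\mathsf D},2_{\mathsf{K4}},2_{\mathsf K}$ add constraints on $\Box\vdash,\vdash\Diamond$: $2_{\mathsf T}$: $\beta$ empty or a single token; $2_{\mathsf D}$: $\beta$ a single token; $2_{\mathsf{K4}}$: $\beta$ nonempty and $\Gamma$ or $\Delta$ contains some $B^{\alpha\circ\beta\circ\eta}$; $2_{\mathsf K}$: $\beta$ a single token and $\Gamma$ or $\Delta$ contains some $B^{\alpha\circ\beta\circ\eta}$. In $2_{\mathsf K},2_{\mathsf{K4}}$ Cut requires $\alpha\in I(\Gamma_1,\Delta_1)$ or $\alpha\in I(\Gamma_2,\Delta_2)$. -}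

module Defs where

open import Data.Nat using (ℕ)
open import Data.List using (List; []; _∷_; _++_; _∷ʳ_)
open import Data.List.Membership.Propositional using (_∈_; _∉_)
open import Data.List.Relation.Unary.Unique.Propositional using (Unique)
open import Data.Product using (Σ; _×_; _,_; ∃)
open import Data.Sum using (_⊎_)
open import Data.Unit using (⊤)
open import Relation.Nullary using (¬_)
open import Relation.Binary.PropositionalEquality using (_≡_; _≢_)

data Formula : Set where
  atom : ℕ → Formula
  ¬′   : Formula → Formula
  _∧′_ : Formula → Formula → Formula
  _∨′_ : Formula → Formula → Formula
  _⇒′_ : Formula → Formula → Formula
  □′   : Formula → Formula
  ◇′   : Formula → Formula

Token : Set
Token = ℕ

Position : Set
Position = List Token

_≼_ : Position → Position → Set
β ≼ α = ∃ λ γ → β ++ γ ≡ α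

record PFormula : Set where
  constructor _^_
  field
    formula  : Formula
    position : Position

open PFormula public

_∈I_ : Position → List PFormula → Set
β ∈I Γ = Σ PFormula λ P → P ∈ Γ × β ≼ position P

_∉I_ : Position → List PFormula → Set
β ∉I Γ = ¬ (β ∈I Γ)

data Logic : Set where
  K D T K4 S4 : Logic

Contains-ext : Position → Position → List PFormula → List PFormula → Set
Contains-ext α β Γ Δ =
  Σ Formula λ B → Σ Position λ η → (B ^ (α ++ β ++ η)) ∈ (Γ ++ Δ)

-- side condition on β in (□⊢) and (⊢◇), with conclusion Γ', (□A)^α ⊢ Δ
-- where Γ, Δ are the context p-formulas of the rule
ModalCond : Logic → Position → Position → List PFormula → List PFormula → Set
ModalCond S4 α β Γ Δ = ⊤
ModalCond T  α β Γ Δ = β ≡ [] ⊎ (∃ λ (x : Token) → β ≡ x ∷ [])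
ModalCond D  α β Γ Δ = ∃ λ (x : Token) → β ≡ x ∷ []
ModalCond K4 α β Γ Δ = β ≢ [] × Contains-ext α β Γ Δ
ModalCond K  α β Γ Δ = (∃ λ (x : Token) → β ≡ x ∷ []) × Contains-ext α β Γ Δ

CutCond : Logic → Position → List PFormula → List PFormula
        → List PFormula → List PFormula → Set
CutCond K  α Γ₁ Δ₁ Γ₂ Δ₂ = α ∈I (Γ₁ ++ Δ₁) ⊎ α ∈I (Γ₂ ++ Δ₂)
CutCond K4 α Γ₁ Δ₁ Γ₂ Δ₂ = α ∈I (Γ₁ ++ Δ₁) ⊎ α ∈I (Γ₂ ++ Δ₂)
CutCond D  α Γ₁ Δ₁ Γ₂ Δ₂ = ⊤
CutCond T  α Γ₁ Δ₁ Γ₂ Δ₂ = ⊤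
CutCond S4 α Γ₁ Δ₁ Γ₂ Δ₂ = ⊤

-- 2_M-proofs of 2-sequents Γ ⊢ Δ.
-- Sequence notation: "Γ, A" on the left is Γ ∷ʳ A, "A, Δ" on the right
-- is A ∷ Δ, "Γ₁, Γ₂" is Γ₁ ++ Γ₂.


data Proof (M : Logic) : List PFormula → List PFormula → Set where
  ax   : ∀ {A α} → Proof M ((A ^ α) ∷ []) ((A ^ α) ∷ [])
  cut  : ∀ {Γ₁ Δ₁ Γ₂ Δ₂ A α} → CutCond M α Γ₁ Δ₁ Γ₂ Δ₂ →
         Proof M Γ₁ ((A ^ α) ∷ Δ₁) → Proof M (Γ₂ ∷ʳ (A ^ α)) Δ₂ →
         Proof M (Γ₁ ++ Γ₂) (Δ₁ ++ Δ₂)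
  wl   : ∀ {Γ Δ P} → Proof M Γ Δ → Proof M (Γ ∷ʳ P) Δ
  wr   : ∀ {Γ Δ P} → Proof M Γ Δ → Proof M Γ (P ∷ Δ)
  cl   : ∀ {Γ Δ P} → Proof M ((Γ ∷ʳ P) ∷ʳ P) Δ → Proof M (Γ ∷ʳ P) Δ
  cr   : ∀ {Γ Δ P} → Proof M Γ (P ∷ P ∷ Δ) → Proof M Γ (P ∷ Δ)
  xl   : ∀ {Γ₁ Γ₂ Δ P Q} → Proof M (Γ₁ ++ P ∷ Q ∷ Γ₂) Δ →
         Proof M (Γ₁ ++ Q ∷ P ∷ Γ₂) Δ
  xr   : ∀ {Γ Δ₁ Δ₂ P Q} → Proof M Γ (Δ₁ ++ P ∷ Q ∷ Δ₂) →
         Proof M Γ (Δ₁ ++ Q ∷ P ∷ Δ₂)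
  ¬l   : ∀ {Γ Δ A α} → Proof M Γ ((A ^ α) ∷ Δ) → Proof M (Γ ∷ʳ (¬′ A ^ α)) Δ
  ¬r   : ∀ {Γ Δ A α} → Proof M (Γ ∷ʳ (A ^ α)) Δ → Proof M Γ ((¬′ A ^ α) ∷ Δ)
  ∧l₁  : ∀ {Γ Δ A B α} → Proof M (Γ ∷ʳ (A ^ α)) Δ →
         Proof M (Γ ∷ʳ ((A ∧′ B) ^ α)) Δ
  ∧l₂  : ∀ {Γ Δ A B α} → Proof M (Γ ∷ʳ (B ^ α)) Δ →
         Proof M (Γ ∷ʳ ((A ∧′ B) ^ α)) Δ
  ∧r   : ∀ {Γ Δ A B α} → Proof M Γ ((A ^ α) ∷ Δ) → Proof M Γ ((B ^ α) ∷ Δ) →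
         Proof M Γ (((A ∧′ B) ^ α) ∷ Δ)
  ∨l   : ∀ {Γ Δ A B α} → Proof M (Γ ∷ʳ (A ^ α)) Δ → Proof M (Γ ∷ʳ (B ^ α)) Δ →
         Proof M (Γ ∷ʳ ((A ∨′ B) ^ α)) Δ
  ∨r₁  : ∀ {Γ Δ A B α} → Proof M Γ ((A ^ α) ∷ Δ) →
         Proof M Γ (((A ∨′ B) ^ α) ∷ Δ)
  ∨r₂  : ∀ {Γ Δ A B α} → Proof M Γ ((B ^ α) ∷ Δ) →
         Proof M Γ (((A ∨′ B) ^ α) ∷ Δ)
  ⇒l   : ∀ {Γ₁ Δ₁ Γ₂ Δ₂ A B α} → Proof M Γ₁ ((A ^ α) ∷ Δ₁) →
         Proof M (Γ₂ ∷ʳ (B ^ α)) Δ₂ →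
         Proof M ((Γ₁ ++ Γ₂) ∷ʳ ((A ⇒′ B) ^ α)) (Δ₁ ++ Δ₂)
  ⇒r   : ∀ {Γ Δ A B α} → Proof M (Γ ∷ʳ (A ^ α)) ((B ^ α) ∷ Δ) →
         Proof M Γ (((A ⇒′ B) ^ α) ∷ Δ)
  □l   : ∀ {Γ Δ A α} (β : Position) → ModalCond M α β Γ Δ →
         Proof M (Γ ∷ʳ (A ^ (α ++ β))) Δ → Proof M (Γ ∷ʳ (□′ A ^ α)) Δ
  □r   : ∀ {Γ Δ A α} (x : Token) → (α ∷ʳ x) ∉I (Γ ++ Δ) →
         Proof M Γ ((A ^ (α ∷ʳ x)) ∷ Δ) → Proof M Γ ((□′ A ^ α) ∷ Δ)
  ◇l   : ∀ {Γ Δ A α} (x : Token) → (α ∷ʳ x) ∉I (Γ ++ Δ) →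
         Proof M (Γ ∷ʳ (A ^ (α ∷ʳ x))) Δ → Proof M (Γ ∷ʳ (◇′ A ^ α)) Δ
  ◇r   : ∀ {Γ Δ A α} (β : Position) → ModalCond M α β Γ Δ →
         Proof M Γ ((A ^ (α ++ β)) ∷ Δ) → Proof M Γ ((◇′ A ^ α) ∷ Δ)

eigenpositions : ∀ {M Γ Δ} → Proof M Γ Δ → List Position
eigenpositions ax          = []
eigenpositions (cut _ p q) = eigenpositions p ++ eigenpositions q
eigenpositions (wl p)      = eigenpositions p
eigenpositions (wr p)      = eigenpositions p
eigenpositions (cl p)      = eigenpositions p
eigenpositions (cr p)      = eigenpositions p
eigenpositions (xl p)      = eigenpositions p
eigenpositions (xr p)      = eigenpositions p
eigenpositions (¬l p)      = eigenpositions p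
eigenpositions (¬r p)      = eigenpositions p
eigenpositions (∧l₁ p)     = eigenpositions p
eigenpositions (∧l₂ p)     = eigenpositions p
eigenpositions (∧r p q)    = eigenpositions p ++ eigenpositions q
eigenpositions (∨l p q)    = eigenpositions p ++ eigenpositions q
eigenpositions (∨r₁ p)     = eigenpositions p
eigenpositions (∨r₂ p)     = eigenpositions p
eigenpositions (⇒l p q)    = eigenpositions p ++ eigenpositions q
eigenpositions (⇒r p)      = eigenpositions p
eigenpositions (□l _ _ p)  = eigenpositions p
eigenpositions (□r {α = α} x _ p) = (α ∷ʳ x) ∷ eigenpositions p
eigenpositions (◇l {α = α} x _ p) = (α ∷ʳ x) ∷ eigenpositions p
eigenpositions (◇r _ _ p)  = eigenpositions p

EigenDistinct : ∀ {M Γ Δ} → Proof M Γ Δ → Set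
EigenDistinct p = Unique (eigenpositions p)

module Submission where

-- A proof is rebuilt bottom-up along a renaming ρ, which gives every token t
-- occurring directly below a node u of the position tree a new name ρ u t.
-- Renaming all p-formulas of an inference yields an inference of the same
-- logic, since the side conditions of Cut and of the modal rules only speak
-- about prefixes, which renaming respects.  At an eigenrule with eigenposition
-- α∘x, ρ is overridden at (α, x) by a fresh token c from a growing counter, so
-- the new eigenposition is ρ(α)∘c.  The invariant "ρ is injective below each
-- node on the tokens < N of the proof, with values < c" keeps ρ(α)∘c fresh;
-- eigenpositions of a subproof relabelled from counter c end in distinct
-- tokens of an interval [c, c′), and sibling subproofs use disjoint intervals.
-- The theorem is the relabelling under the identity renaming, with N above
-- every token of the proof, which leaves the end sequent unchanged.

open import Defs
open import Data.Empty using (⊥-elim)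
open import Data.List using (List; []; _∷_; _++_; _∷ʳ_; [_]; map; concatMap)
open import Data.List.Extrema.Nat using (max; xs≤max)
open import Data.List.Membership.Propositional using (_∈_)
open import Data.List.Membership.Propositional.Properties
  using (∈-map⁺; ∈-map⁻; ∈-++⁺ˡ; ∈-++⁺ʳ)
open import Data.List.Properties
  using (map-++; ++-assoc; ++-identityʳ; ++-identityʳ-unique; ∷-injective; ∷ʳ-injectiveʳ; ≡-dec)
open import Data.List.Relation.Unary.All as All using (All; []; _∷_)
open import Data.List.Relation.Unary.Any using (here; there)
import Data.List.Relation.Unary.All.Properties as AllP
open import Data.List.Relation.Unary.AllPairs using ([]; _∷_)
open import Data.List.Relation.Unary.Unique.Propositional using (Unique)
import Data.List.Relation.Unary.Unique.Propositional.Properties as UniqueP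
open import Data.Nat using (ℕ; suc; _≤_; _<_; _⊔_; _≟_)
open import Data.Nat.Properties
  using (≤-refl; ≤-trans; <-≤-trans; ≤-<-trans; <-irrefl; n≤1+n; m≤n⇒m≤1+n;
         m⊔n<o⇒m<o; m⊔n<o⇒n<o)
open import Data.Product using (Σ; _×_; _,_; proj₁; proj₂)
open import Data.Sum using (inj₁; inj₂)
open import Data.Unit using (tt)
open import Relation.Nullary using (¬_; yes; no)
open import Relation.Binary.PropositionalEquality
  using (_≡_; _≢_; refl; sym; trans; cong; cong₂; subst)

-- Renamings of positions

-- ρ u t is the new name of the token t when it occurs directly below u.
Renaming : Set
Renaming = Position → Token → Token

rename-below : Renaming → Position → Position → Position
rename-below ρ u []      = []
rename-below ρ u (t ∷ v) = ρ u t ∷ rename-below ρ (u ∷ʳ t) v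

rename : Renaming → Position → Position
rename ρ = rename-below ρ []

renameP : Renaming → PFormula → PFormula
renameP ρ (A ^ α) = A ^ rename ρ α

renameL : Renaming → List PFormula → List PFormula
renameL ρ = map (renameP ρ)

rename-below-++ : ∀ ρ u v w →
  rename-below ρ u (v ++ w) ≡ rename-below ρ u v ++ rename-below ρ (u ++ v) w
rename-below-++ ρ u []      w = cong (λ u′ → rename-below ρ u′ w) (sym (++-identityʳ u))
rename-below-++ ρ u (t ∷ v) w =
  cong (ρ u t ∷_) (trans (rename-below-++ ρ (u ∷ʳ t) v w)
    (cong (λ u′ → rename-below ρ (u ∷ʳ t) v ++ rename-below ρ u′ w) (++-assoc u [ t ] v)))

renameL-++ : ∀ ρ Γ Δ → renameL ρ (Γ ++ Δ) ≡ renameL ρ Γ ++ renameL ρ Δ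
renameL-++ ρ = map-++ (renameP ρ)

renameL-∷ʳ : ∀ ρ Γ P → renameL ρ (Γ ∷ʳ P) ≡ renameL ρ Γ ∷ʳ renameP ρ P
renameL-∷ʳ ρ Γ P = map-++ (renameP ρ) Γ [ P ]

ρ-id : Renaming
ρ-id u t = t

rename-below-id : ∀ u v → rename-below ρ-id u v ≡ v
rename-below-id u []      = refl
rename-below-id u (t ∷ v) = cong (t ∷_) (rename-below-id (u ∷ʳ t) v)

renameL-id : ∀ L → renameL ρ-id L ≡ L
renameL-id []            = refl
renameL-id ((A ^ α) ∷ L) = cong₂ _∷_ (cong (A ^_) (rename-below-id [] α)) (renameL-id L)

-- Renaming preserves the side conditions of the rules

∈I-rename : ∀ ρ {α} Γ → α ∈I Γ → rename ρ α ∈I renameL ρ Γ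
∈I-rename ρ {α} Γ ((A ^ v) , m , γ , refl) =
  (A ^ rename ρ (α ++ γ)) , ∈-map⁺ (renameP ρ) m , rename-below ρ α γ ,
  sym (rename-below-++ ρ [] α γ)

∈I-rename-++ : ∀ ρ {α} Γ Δ → α ∈I (Γ ++ Δ) → rename ρ α ∈I (renameL ρ Γ ++ renameL ρ Δ)
∈I-rename-++ ρ Γ Δ h = subst (_ ∈I_) (renameL-++ ρ Γ Δ) (∈I-rename ρ (Γ ++ Δ) h)

cutCond-rename : ∀ M ρ {α Γ₁ Δ₁ Γ₂ Δ₂} → CutCond M α Γ₁ Δ₁ Γ₂ Δ₂ →
  CutCond M (rename ρ α) (renameL ρ Γ₁) (renameL ρ Δ₁) (renameL ρ Γ₂) (renameL ρ Δ₂)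
cutCond-rename K  ρ {Γ₁ = Γ₁} {Δ₁} (inj₁ h) = inj₁ (∈I-rename-++ ρ Γ₁ Δ₁ h)
cutCond-rename K  ρ {Γ₂ = Γ₂} {Δ₂} (inj₂ h) = inj₂ (∈I-rename-++ ρ Γ₂ Δ₂ h)
cutCond-rename K4 ρ {Γ₁ = Γ₁} {Δ₁} (inj₁ h) = inj₁ (∈I-rename-++ ρ Γ₁ Δ₁ h)
cutCond-rename K4 ρ {Γ₂ = Γ₂} {Δ₂} (inj₂ h) = inj₂ (∈I-rename-++ ρ Γ₂ Δ₂ h)
cutCond-rename D  ρ _ = tt
cutCond-rename T  ρ _ = tt
cutCond-rename S4 ρ _ = tt

containsExt-rename : ∀ ρ α β Γ Δ → Contains-ext α β Γ Δ →
  Contains-ext (rename ρ α) (rename-below ρ α β) (renameL ρ Γ) (renameL ρ Δ)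
containsExt-rename ρ α β Γ Δ (B , η , m) =
  B , rename-below ρ (α ++ β) η ,
  subst (_∈ (renameL ρ Γ ++ renameL ρ Δ)) (cong (B ^_) renamed)
    (subst (_ ∈_) (renameL-++ ρ Γ Δ) (∈-map⁺ (renameP ρ) m))
  where
  renamed : rename ρ (α ++ β ++ η) ≡ rename ρ α ++ rename-below ρ α β ++ rename-below ρ (α ++ β) η
  renamed = trans (rename-below-++ ρ [] α (β ++ η)) (cong (rename ρ α ++_) (rename-below-++ ρ α β η))

-- Renaming keeps the length of the accessibility step β and its context witness.
modalCond-rename : ∀ M ρ α β Γ Δ → ModalCond M α β Γ Δ →
  ModalCond M (rename ρ α) (rename-below ρ α β) (renameL ρ Γ) (renameL ρ Δ)
modalCond-rename S4 ρ α β          Γ Δ _                  = tt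
modalCond-rename T  ρ α .[]        Γ Δ (inj₁ refl)        = inj₁ refl
modalCond-rename T  ρ α .(y ∷ [])  Γ Δ (inj₂ (y , refl))  = inj₂ (ρ α y , refl)
modalCond-rename D  ρ α .(y ∷ [])  Γ Δ (y , refl)         = ρ α y , refl
modalCond-rename K4 ρ α []         Γ Δ (β≢[] , _)         = ⊥-elim (β≢[] refl)
modalCond-rename K4 ρ α (t ∷ β)    Γ Δ (_ , ext)          =
  (λ ()) , containsExt-rename ρ α (t ∷ β) Γ Δ ext
modalCond-rename K  ρ α .(y ∷ [])  Γ Δ ((y , refl) , ext) =
  (ρ α y , refl) , containsExt-rename ρ α [ y ] Γ Δ ext

override : Renaming → Position → Token → Token → Renaming
override ρ α x c u t with ≡-dec _≟_ u α | t ≟ x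
... | yes _ | yes _ = c
... | yes _ | no _  = ρ u t
... | no _  | _     = ρ u t

override-hit : ∀ ρ α x c → override ρ α x c α x ≡ c
override-hit ρ α x c with ≡-dec _≟_ α α | x ≟ x
... | yes _ | yes _  = refl
... | yes _ | no x≢x = ⊥-elim (x≢x refl)
... | no α≢α | _     = ⊥-elim (α≢α refl)

override-miss : ∀ ρ α x c u t → ¬ (u ≡ α × t ≡ x) → override ρ α x c u t ≡ ρ u t
override-miss ρ α x c u t ¬hit with ≡-dec _≟_ u α | t ≟ x
... | yes u≡α | yes t≡x = ⊥-elim (¬hit (u≡α , t≡x))
... | yes _   | no _    = refl
... | no _    | _       = refl

rename-override-away : ∀ ρ α x c u v → ¬ ((α ∷ʳ x) ≼ (u ++ v)) →
  rename-below (override ρ α x c) u v ≡ rename-below ρ u v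
rename-override-away ρ α x c u []      _     = refl
rename-override-away ρ α x c u (t ∷ v) avoid =
  cong₂ _∷_ (override-miss ρ α x c u t λ { (refl , refl) → avoid (v , ++-assoc α [ x ] v) })
            (rename-override-away ρ α x c (u ∷ʳ t) v
              λ { (γ , eq) → avoid (γ , trans eq (++-assoc u [ t ] v)) })

renameL-override-away : ∀ ρ α x c L → (α ∷ʳ x) ∉I L →
  renameL (override ρ α x c) L ≡ renameL ρ L
renameL-override-away ρ α x c []            _   = refl
renameL-override-away ρ α x c ((A ^ v) ∷ L) new =
  cong₂ _∷_ (cong (A ^_) (rename-override-away ρ α x c [] v λ pre → new (_ , here refl , pre)))
            (renameL-override-away ρ α x c L λ { (P , m , pre) → new (P , there m , pre) })

rename-override-eigen : ∀ ρ α x c → rename (override ρ α x c) (α ∷ʳ x) ≡ rename ρ α ∷ʳ c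
rename-override-eigen ρ α x c =
  trans (rename-below-++ (override ρ α x c) [] α [ x ])
    (cong₂ (λ v t → v ++ [ t ]) (rename-override-away ρ α x c [] α α∘x⋠α) (override-hit ρ α x c))
  where
  α∘x⋠α : ¬ ((α ∷ʳ x) ≼ α)
  α∘x⋠α (γ , eq) with ++-identityʳ-unique α (sym (trans (sym (++-assoc α [ x ] γ)) eq))
  ... | ()

tokens : List PFormula → List Token
tokens = concatMap position

-- The largest token occurring at an eigenrule (in its context or at α); these
-- are the only tokens whose renaming must stay injective.
tokMax : ∀ {M Γ Δ} → Proof M Γ Δ → ℕ
tokMax ax          = 0
tokMax (cut _ p q) = tokMax p ⊔ tokMax q
tokMax (wl p)      = tokMax p
tokMax (wr p)      = tokMax p
tokMax (cl p)      = tokMax p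
tokMax (cr p)      = tokMax p
tokMax (xl p)      = tokMax p
tokMax (xr p)      = tokMax p
tokMax (¬l p)      = tokMax p
tokMax (¬r p)      = tokMax p
tokMax (∧l₁ p)     = tokMax p
tokMax (∧l₂ p)     = tokMax p
tokMax (∧r p q)    = tokMax p ⊔ tokMax q
tokMax (∨l p q)    = tokMax p ⊔ tokMax q
tokMax (∨r₁ p)     = tokMax p
tokMax (∨r₂ p)     = tokMax p
tokMax (⇒l p q)    = tokMax p ⊔ tokMax q
tokMax (⇒r p)      = tokMax p
tokMax (□l _ _ p)  = tokMax p
tokMax (□r {Γ} {Δ} {α = α} _ _ p) = max 0 (α ++ tokens (Γ ++ Δ)) ⊔ tokMax p
tokMax (◇l {Γ} {Δ} {α = α} _ _ p) = max 0 (α ++ tokens (Γ ++ Δ)) ⊔ tokMax p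
tokMax (◇r _ _ p)  = tokMax p

below-max : ∀ {N} α L → max 0 (α ++ tokens L) < N →
  All (_< N) α × All (λ P → All (_< N) (position P)) L
below-max {N} α L lt =
  AllP.++⁻ˡ α below , AllP.map⁻ (AllP.concat⁻ (AllP.++⁻ʳ α below))
  where
  below : All (_< N) (α ++ tokens L)
  below = All.map (λ le → ≤-<-trans le lt) (xs≤max 0 (α ++ tokens L))

-- Renumbering a proof whose tokens are all below N

module Renumbering (N : ℕ) where

  record Admissible (ρ : Renaming) (c : Token) : Set where
    field
      bounded   : ∀ u {t} → t < N → ρ u t < c
      injective : ∀ u {t t′} → t < N → t′ < N → ρ u t ≡ ρ u t′ → t ≡ t′
  open Admissible

  admissible-id : Admissible ρ-id N
  admissible-id = record { bounded = λ _ t<N → t<N ; injective = λ _ _ _ eq → eq }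

  admissible-mono : ∀ {ρ c c′} → c ≤ c′ → Admissible ρ c → Admissible ρ c′
  admissible-mono c≤c′ adm = record
    { bounded = λ u t<N → <-≤-trans (bounded adm u t<N) c≤c′ ; injective = injective adm }

  admissible-override : ∀ {ρ c} α x → Admissible ρ c → Admissible (override ρ α x c) (suc c)
  admissible-override {ρ} {c} α x adm = record { bounded = bnd ; injective = inj }
    where
    bnd : ∀ u {t} → t < N → override ρ α x c u t < suc c
    bnd u {t} t<N with ≡-dec _≟_ u α | t ≟ x
    ... | yes _ | yes _ = ≤-refl
    ... | yes _ | no _  = m≤n⇒m≤1+n (bounded adm u t<N)
    ... | no _  | _     = m≤n⇒m≤1+n (bounded adm u t<N)
    inj : ∀ u {t t′} → t < N → t′ < N → override ρ α x c u t ≡ override ρ α x c u t′ → t ≡ t′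
    inj u {t} {t′} t<N t′<N eq with ≡-dec _≟_ u α | t ≟ x | t′ ≟ x
    ... | yes _ | yes t≡x | yes t′≡x = trans t≡x (sym t′≡x)
    ... | yes _ | yes _   | no _     = ⊥-elim (<-irrefl (sym eq) (bounded adm u t′<N))
    ... | yes _ | no _    | yes _    = ⊥-elim (<-irrefl eq (bounded adm u t<N))
    ... | yes _ | no _    | no _     = injective adm u t<N t′<N eq
    ... | no _  | _       | _        = injective adm u t<N t′<N eq

  -- The fresh token c never occurs in a renamed path of small tokens, so
  -- ρ(α)∘c is not a prefix of any such renamed path.
  fresh-not-prefix : ∀ {ρ c} → Admissible ρ c → ∀ u α v γ → All (_< N) α → All (_< N) v →
    rename-below ρ u α ++ c ∷ γ ≢ rename-below ρ u v
  fresh-not-prefix adm u []      []      γ _         _          ()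
  fresh-not-prefix adm u []      (t ∷ v) γ _         (t<N ∷ _)  eq =
    <-irrefl (sym (proj₁ (∷-injective eq))) (bounded adm u t<N)
  fresh-not-prefix adm u (a ∷ α) []      γ _         _          ()
  fresh-not-prefix adm u (a ∷ α) (t ∷ v) γ (a<N ∷ α<N) (t<N ∷ v<N) eq
    with ∷-injective eq
  ... | head≡ , tail≡ with injective adm u a<N t<N head≡
  ... | refl = fresh-not-prefix adm (u ∷ʳ a) α v γ α<N v<N tail≡

  eigen-context : ∀ {ρ c} α x Γ Δ → Admissible ρ c → (α ∷ʳ x) ∉I (Γ ++ Δ) →
    max 0 (α ++ tokens (Γ ++ Δ)) < N →
    renameL (override ρ α x c) Γ ≡ renameL ρ Γ × renameL (override ρ α x c) Δ ≡ renameL ρ Δ ×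
    (rename ρ α ∷ʳ c) ∉I (renameL ρ Γ ++ renameL ρ Δ)
  eigen-context {ρ} {c} α x Γ Δ adm new lt =
    renameL-override-away ρ α x c Γ (λ { (P , m , pre) → new (P , ∈-++⁺ˡ m , pre) }) ,
    renameL-override-away ρ α x c Δ (λ { (P , m , pre) → new (P , ∈-++⁺ʳ Γ m , pre) }) ,
    fresh
    where
    bounds : All (_< N) α × All (λ P → All (_< N) (position P)) (Γ ++ Δ)
    bounds = below-max α (Γ ++ Δ) lt
    fresh : (rename ρ α ∷ʳ c) ∉I (renameL ρ Γ ++ renameL ρ Δ)
    fresh (P , m , γ , eq) with ∈-map⁻ (renameP ρ) (subst (P ∈_) (sym (renameL-++ ρ Γ Δ)) m)
    ... | (A ^ v) , m′ , refl =
      fresh-not-prefix adm [] α v γ (proj₁ bounds) (All.lookup (proj₂ bounds) m′)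
        (trans (sym (++-assoc (rename ρ α) [ c ] γ)) eq)

  EndsIn : Token → Token → Position → Set
  EndsIn c c′ e = Σ Position λ u → Σ Token λ z → e ≡ u ∷ʳ z × c ≤ z × z < c′

  -- A proof of Γ ⊢ Δ with distinct eigenpositions, all ending in tokens from
  -- [c, next); "next" is the first token still unused afterwards.
  record Relabelled (M : Logic) (Γ Δ : List PFormula) (c : Token) : Set where
    field
      next     : Token
      c≤next   : c ≤ next
      proof    : Proof M Γ Δ
      ranges   : All (EndsIn c next) (eigenpositions proof)
      distinct : Unique (eigenpositions proof)
  open Relabelled public

  castˡ : ∀ {M Γ Γ′ Δ c} → Γ ≡ Γ′ → Relabelled M Γ Δ c → Relabelled M Γ′ Δ c
  castˡ refl r = r

  castʳ : ∀ {M Γ Δ Δ′ c} → Δ ≡ Δ′ → Relabelled M Γ Δ c → Relabelled M Γ Δ′ c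
  castʳ refl r = r

  infer₁ : ∀ {M Γ Δ Γ′ Δ′ c} (rule : Proof M Γ Δ → Proof M Γ′ Δ′) →
    (∀ p → eigenpositions (rule p) ≡ eigenpositions p) →
    Relabelled M Γ Δ c → Relabelled M Γ′ Δ′ c
  infer₁ rule same r = record
    { next = next r ; c≤next = c≤next r ; proof = rule (proof r)
    ; ranges = subst (All _) (sym (same (proof r))) (ranges r)
    ; distinct = subst Unique (sym (same (proof r))) (distinct r) }

  -- A two-premise rule whose second premise was relabelled after the first:
  -- the token intervals [c, c₁) and [c₁, c₂) are disjoint.
  infer₂ : ∀ {M Γ₁ Δ₁ Γ₂ Δ₂ Γ′ Δ′ c}
    (rule : Proof M Γ₁ Δ₁ → Proof M Γ₂ Δ₂ → Proof M Γ′ Δ′) →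
    (∀ p q → eigenpositions (rule p q) ≡ eigenpositions p ++ eigenpositions q) →
    (r₁ : Relabelled M Γ₁ Δ₁ c) → Relabelled M Γ₂ Δ₂ (next r₁) → Relabelled M Γ′ Δ′ c
  infer₂ rule split r₁ r₂ = record
    { next = next r₂ ; c≤next = ≤-trans (c≤next r₁) (c≤next r₂) ; proof = rule p q
    ; ranges = subst (All _) (sym (split p q)) (AllP.++⁺
        (All.map (λ { (u , z , eq , c≤z , z<c₁) → u , z , eq , c≤z , <-≤-trans z<c₁ (c≤next r₂) })
                 (ranges r₁))
        (All.map (λ { (u , z , eq , c₁≤z , z<c₂) → u , z , eq , ≤-trans (c≤next r₁) c₁≤z , z<c₂ })
                 (ranges r₂)))
    ; distinct = subst Unique (sym (split p q)) (UniqueP.++⁺ (distinct r₁) (distinct r₂) disjoint) }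
    where
    p = proof r₁
    q = proof r₂
    disjoint : ∀ {e} → ¬ (e ∈ eigenpositions p × e ∈ eigenpositions q)
    disjoint (e∈p , e∈q) with All.lookup (ranges r₁) e∈p | All.lookup (ranges r₂) e∈q
    ... | u , z , refl , _ , z<c₁ | u′ , z′ , eq , c₁≤z′ , _ =
      <-irrefl (∷ʳ-injectiveʳ u u′ eq) (<-≤-trans z<c₁ c₁≤z′)

  inferEigen : ∀ {M Γ Δ Γ′ Δ′ c} (u : Position) (rule : Proof M Γ Δ → Proof M Γ′ Δ′) →
    (∀ p → eigenpositions (rule p) ≡ (u ∷ʳ c) ∷ eigenpositions p) →
    Relabelled M Γ Δ (suc c) → Relabelled M Γ′ Δ′ c
  inferEigen {c = c} u rule adds r = record
    { next = next r ; c≤next = c≤next′ ; proof = rule (proof r)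
    ; ranges = subst (All _) (sym (adds (proof r)))
        ((u , c , refl , ≤-refl , c≤next r) ∷
          All.map (λ { (w , z , eq , c<z , z<n) → w , z , eq , ≤-trans (n≤1+n c) c<z , z<n }) (ranges r))
    ; distinct = subst Unique (sym (adds (proof r)))
        (All.map (λ { (w , z , refl , c<z , _) eq → <-irrefl (∷ʳ-injectiveʳ u w eq) c<z }) (ranges r)
          ∷ distinct r) }
    where
    c≤next′ : c ≤ next r
    c≤next′ = ≤-trans (n≤1+n c) (c≤next r)

  relabel : ∀ {M Γ Δ} (p : Proof M Γ Δ) (ρ : Renaming) (c : Token) → tokMax p < N →
    Admissible ρ c → Relabelled M (renameL ρ Γ) (renameL ρ Δ) c
  relabel ax ρ c _ _ = record { next = c ; c≤next = ≤-refl ; proof = ax ; ranges = [] ; distinct = [] }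
  relabel {M} (cut {Γ₁} {Δ₁} {Γ₂} {Δ₂} {A} {α} cc p q) ρ c b adm =
    castˡ (sym (renameL-++ ρ Γ₁ Γ₂)) (castʳ (sym (renameL-++ ρ Δ₁ Δ₂))
      (infer₂ (cut (cutCond-rename M ρ cc)) (λ _ _ → refl) r
        (castˡ (renameL-∷ʳ ρ Γ₂ (A ^ α))
          (relabel q ρ (next r) (m⊔n<o⇒n<o _ _ b) (admissible-mono (c≤next r) adm)))))
    where r = relabel p ρ c (m⊔n<o⇒m<o _ _ b) adm
  relabel (wl {Γ} {Δ} {P} p) ρ c b adm =
    castˡ (sym (renameL-∷ʳ ρ Γ P)) (infer₁ wl (λ _ → refl) (relabel p ρ c b adm))
  relabel (wr p) ρ c b adm = infer₁ wr (λ _ → refl) (relabel p ρ c b adm)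
  relabel (cl {Γ} {Δ} {P} p) ρ c b adm =
    castˡ (sym (renameL-∷ʳ ρ Γ P)) (infer₁ cl (λ _ → refl)
      (castˡ (trans (renameL-∷ʳ ρ (Γ ∷ʳ P) P) (cong (_∷ʳ renameP ρ P) (renameL-∷ʳ ρ Γ P)))
        (relabel p ρ c b adm)))
  relabel (cr p) ρ c b adm = infer₁ cr (λ _ → refl) (relabel p ρ c b adm)
  relabel (xl {Γ₁} {Γ₂} {Δ} {P} {Q} p) ρ c b adm =
    castˡ (sym (renameL-++ ρ Γ₁ (Q ∷ P ∷ Γ₂))) (infer₁ xl (λ _ → refl)
      (castˡ (renameL-++ ρ Γ₁ (P ∷ Q ∷ Γ₂)) (relabel p ρ c b adm)))
  relabel (xr {Γ} {Δ₁} {Δ₂} {P} {Q} p) ρ c b adm =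
    castʳ (sym (renameL-++ ρ Δ₁ (Q ∷ P ∷ Δ₂))) (infer₁ xr (λ _ → refl)
      (castʳ (renameL-++ ρ Δ₁ (P ∷ Q ∷ Δ₂)) (relabel p ρ c b adm)))
  relabel (¬l {Γ} {Δ} {A} {α} p) ρ c b adm =
    castˡ (sym (renameL-∷ʳ ρ Γ (¬′ A ^ α))) (infer₁ ¬l (λ _ → refl) (relabel p ρ c b adm))
  relabel (¬r {Γ} {Δ} {A} {α} p) ρ c b adm =
    infer₁ ¬r (λ _ → refl) (castˡ (renameL-∷ʳ ρ Γ (A ^ α)) (relabel p ρ c b adm))
  relabel (∧l₁ {Γ} {Δ} {A} {B} {α} p) ρ c b adm =
    castˡ (sym (renameL-∷ʳ ρ Γ ((A ∧′ B) ^ α))) (infer₁ ∧l₁ (λ _ → refl)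
      (castˡ (renameL-∷ʳ ρ Γ (A ^ α)) (relabel p ρ c b adm)))
  relabel (∧l₂ {Γ} {Δ} {A} {B} {α} p) ρ c b adm =
    castˡ (sym (renameL-∷ʳ ρ Γ ((A ∧′ B) ^ α))) (infer₁ ∧l₂ (λ _ → refl)
      (castˡ (renameL-∷ʳ ρ Γ (B ^ α)) (relabel p ρ c b adm)))
  relabel (∧r p q) ρ c b adm =
    infer₂ ∧r (λ _ _ → refl) r
      (relabel q ρ (next r) (m⊔n<o⇒n<o _ _ b) (admissible-mono (c≤next r) adm))
    where r = relabel p ρ c (m⊔n<o⇒m<o _ _ b) adm
  relabel (∨l {Γ} {Δ} {A} {B} {α} p q) ρ c b adm =
    castˡ (sym (renameL-∷ʳ ρ Γ ((A ∨′ B) ^ α)))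
      (infer₂ ∨l (λ _ _ → refl) r
        (castˡ (renameL-∷ʳ ρ Γ (B ^ α))
          (relabel q ρ (next r) (m⊔n<o⇒n<o _ _ b) (admissible-mono (c≤next r) adm))))
    where r = castˡ (renameL-∷ʳ ρ Γ (A ^ α)) (relabel p ρ c (m⊔n<o⇒m<o _ _ b) adm)
  relabel (∨r₁ p) ρ c b adm = infer₁ ∨r₁ (λ _ → refl) (relabel p ρ c b adm)
  relabel (∨r₂ p) ρ c b adm = infer₁ ∨r₂ (λ _ → refl) (relabel p ρ c b adm)
  relabel (⇒l {Γ₁} {Δ₁} {Γ₂} {Δ₂} {A} {B} {α} p q) ρ c b adm =
    castˡ (sym (trans (renameL-∷ʳ ρ (Γ₁ ++ Γ₂) ((A ⇒′ B) ^ α))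
                      (cong (_∷ʳ ((A ⇒′ B) ^ rename ρ α)) (renameL-++ ρ Γ₁ Γ₂))))
      (castʳ (sym (renameL-++ ρ Δ₁ Δ₂))
        (infer₂ ⇒l (λ _ _ → refl) r
          (castˡ (renameL-∷ʳ ρ Γ₂ (B ^ α))
            (relabel q ρ (next r) (m⊔n<o⇒n<o _ _ b) (admissible-mono (c≤next r) adm)))))
    where r = relabel p ρ c (m⊔n<o⇒m<o _ _ b) adm
  relabel (⇒r {Γ} {Δ} {A} {B} {α} p) ρ c b adm =
    infer₁ ⇒r (λ _ → refl) (castˡ (renameL-∷ʳ ρ Γ (A ^ α)) (relabel p ρ c b adm))
  relabel {M} (□l {Γ} {Δ} {A} {α} β cond p) ρ c b adm =
    castˡ (sym (renameL-∷ʳ ρ Γ (□′ A ^ α)))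
      (infer₁ (□l (rename-below ρ α β) (modalCond-rename M ρ α β Γ Δ cond)) (λ _ → refl)
        (castˡ (trans (renameL-∷ʳ ρ Γ (A ^ (α ++ β)))
                      (cong (λ v → renameL ρ Γ ∷ʳ (A ^ v)) (rename-below-++ ρ [] α β)))
          (relabel p ρ c b adm)))
  relabel {M} (◇r {Γ} {Δ} {A} {α} β cond p) ρ c b adm =
    infer₁ (◇r (rename-below ρ α β) (modalCond-rename M ρ α β Γ Δ cond)) (λ _ → refl)
      (castʳ (cong (λ v → (A ^ v) ∷ renameL ρ Δ) (rename-below-++ ρ [] α β)) (relabel p ρ c b adm))
  relabel (□r {Γ} {Δ} {A} {α} x new p) ρ c b adm
    with eigen-context α x Γ Δ adm new (m⊔n<o⇒m<o _ _ b)
  ... | sameΓ , sameΔ , fresh =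
    inferEigen (rename ρ α) (□r c fresh) (λ _ → refl)
      (castˡ sameΓ (castʳ (cong₂ (λ v L → (A ^ v) ∷ L) (rename-override-eigen ρ α x c) sameΔ)
        (relabel p (override ρ α x c) (suc c) (m⊔n<o⇒n<o _ _ b) (admissible-override α x adm))))
  relabel (◇l {Γ} {Δ} {A} {α} x new p) ρ c b adm
    with eigen-context α x Γ Δ adm new (m⊔n<o⇒m<o _ _ b)
  ... | sameΓ , sameΔ , fresh =
    castˡ (sym (renameL-∷ʳ ρ Γ (◇′ A ^ α)))
      (inferEigen (rename ρ α) (◇l c fresh) (λ _ → refl)
        (castˡ (trans (renameL-∷ʳ (override ρ α x c) Γ (A ^ (α ∷ʳ x)))
                      (cong₂ (λ L v → L ∷ʳ (A ^ v)) sameΓ (rename-override-eigen ρ α x c)))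
          (castʳ sameΔ
            (relabel p (override ρ α x c) (suc c) (m⊔n<o⇒n<o _ _ b) (admissible-override α x adm)))))

mainTheorem7 : (M : Logic) (Γ Δ : List PFormula) → Proof M Γ Δ →
    Σ (Proof M Γ Δ) (λ Π′ → EigenDistinct Π′)
mainTheorem7 M Γ Δ p = proof r , distinct r
  where
  open Renumbering (suc (tokMax p))
  r : Relabelled M Γ Δ (suc (tokMax p))
  r = castˡ (renameL-id Γ) (castʳ (renameL-id Δ)
        (relabel p ρ-id (suc (tokMax p)) ≤-refl admissible-id))
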